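{- Let $m>n\ge2$ be integers. Then $\mathsf{PHP}^m_n\not\le\mathsf{id}_{\binom{n+1}{2}-1}$. Consequently, for every $k\ge1$, $\mathsf{PHP}^m_n\le\mathsf{id}_k$ if and only if $k\ge\binom{n+1}{2}$.
   Context: A number $N\ge1$ is identified with $\{0,\dots,N-1\}$. A (finite) problem $\mathsf{P}$ consists of a nonempty finite set of instances and, for each instance $x$, a nonempty finite set $\mathsf{P}(x)$ of solutions. For finite problems, $\mathsf{P}\le\mathsf{Q}$ if there exist a map $\Phi$ sending each $\mathsf{P}$-instance $x$ to a $\mathsf{Q}$-instance and a (partial) map $\Psi$ on $\mathsf{Q}$-solutions such that $\Psi(y)\in\mathsf{P}(x)$ whenever $y\in\mathsf{Q}(\Phi(x))$. For $m>n\ge2$, $\mathsf{PHP}^m_n$ has as instances all functions $f:m\to n$, with solutions all unordered pairs $\{i,j\}$, $i\ne j$, $f(i)=f(j)$. For $k\ge1$, $\mathsf{id}_k$ has instances $j\in\{1,\dots,k\}$, each instance $j$ having unique solution $j$. -}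

module Defs where

open import Data.Nat using (ℕ)
open import Data.Fin using (Fin) renaming (_<_ to _<ᶠ_)
open import Data.Maybe using (Maybe; just)
open import Data.Product using (Σ; _×_; ∃)
open import Relation.Binary.PropositionalEquality using (_≡_)

record Problem : Set₁ where
  field
    Inst : Set
    Cand : Set
    IsSol : Inst → Cand → Set
open Problem public

record _≤ᴾ_ (P Q : Problem) : Set where
  field
    Φ : Inst P → Inst Q
    Ψ : Cand Q → Maybe (Cand P)
    correct : ∀ (x : Inst P) (y : Cand Q) → IsSol Q (Φ x) y →
              Σ (Cand P) λ s → (Ψ y ≡ just s) × IsSol P x s

-- PHP^m_n : instances f : m → n; solutions unordered pairs {i,j}, i ≠ j, f i = f j.
-- An unordered pair {i,j} is represented canonically by (i , j) with i < j.
PHP : ℕ → ℕ → Problem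
PHP m n = record
  { Inst = Fin m → Fin n
  ; Cand = Fin m × Fin m
  ; IsSol = λ f ij → (Data.Product.proj₁ ij <ᶠ Data.Product.proj₂ ij)
                     × (f (Data.Product.proj₁ ij) ≡ f (Data.Product.proj₂ ij))
  }

idP : ℕ → Problem
idP k = record
  { Inst = Fin k
  ; Cand = Fin k
  ; IsSol = λ j y → y ≡ j
  }

{-# OPTIONS --safe #-}
module Submission where

-- Read the candidate pairs Ψ 0, …, Ψ (k-1) of a reduction PHP^m_n ≤ id_k as the edges of a
-- multigraph on the m pigeons.  Fewer than C(n+1,2) edges admit a proper n-colouring: while
-- more than n vertices remain, the degree sum 2|E| < n(n+1) forces a vertex of degree < n,
-- which is removed and coloured last.  For such a colouring f, the pair Ψ (Φ f) would be an
-- edge and a collision of f at once.  Conversely, with C(n+1,2) instances Φ f can name a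
-- collision of f among the first n+1 pigeons.

open import Defs
open import Data.Nat
  using (ℕ; zero; suc; _+_; _*_; _∸_; _≤_; _<_; _≥_; z≤n; s≤s; z<s; s<s⁻¹; _≤?_; _<?_)
open import Data.Nat.Properties as NP
  using ( ≤-trans; ≤-reflexive; ≤-<-trans; +-mono-≤; m≤n+m; m≤n⇒m≤1+n; m≤m+n; n<1+n
        ; *-suc; *-comm; *-distribˡ-+; *-distribʳ-+; *-monoʳ-≤; *-monoʳ-<
        ; ≰⇒>; <⇒≱; ≮⇒≥; ∸-monoʳ-<)
open import Data.Nat.Combinatorics using (_C_; nC1≡n; nCk+nC[k+1]≡[n+1]C[k+1])
open import Algebra.Properties.CommutativeMonoid.Sum NP.+-0-commutativeMonoid
  using (sum; ∑-distrib-+; sum-replicate-zero)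
open import Data.Fin using (Fin; zero; suc; toℕ; fromℕ<; inject≤; punchOut; punchIn)
  renaming (_<_ to _<ᶠ_)
open import Data.Fin.Properties
  using ( _≟_; ¬∀⟶∃¬; pigeonhole; punchOut-injective; punchIn-punchOut; inject≤-injective
        ; toℕ-inject≤; toℕ-fromℕ<; toℕ-injective; toℕ<n; <⇒≢)
open import Data.Vec.Functional using (Vector; insertAt)
open import Data.Vec.Functional.Properties using (insertAt-lookup; insertAt-punchIn)
open import Data.Maybe as Maybe using (Maybe; just; nothing)
open import Data.List using (List; []; _∷_; length; map; _++_; lookup; tabulate; allFin; catMaybes)
open import Data.List.Properties using (length-map; length-++; length-tabulate; length-catMaybes)
open import Data.List.Relation.Unary.All as All using (All; []; _∷_)
open import Data.List.Relation.Unary.Any as Any using (Any; here; there)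
open import Data.List.Relation.Unary.Any.Properties using (lookup-index)
open import Data.List.Membership.Propositional using (_∈_; _∉_; lose)
open import Data.List.Membership.Propositional.Properties
  using (∈-allFin; ∈-map⁺; ∈-++⁺ˡ; ∈-++⁺ʳ; ∈-tabulate⁺)
open import Data.List.Membership.Setoid.Properties using (index-injective)
open import Data.Product as Product using (∃; _×_; _,_)
open import Function using (_∘_; id)
open import Function.Bundles using (_⇔_; mk⇔)
open import Relation.Nullary using (¬_; yes; no; contradiction)
open import Relation.Binary.PropositionalEquality
  using (_≡_; _≢_; refl; sym; trans; cong; cong₂; subst; subst₂; setoid; module ≡-Reasoning)

private
  variable
    A : Set
    k m n : ℕ

[1+n]C2≡n+nC2 : ∀ n → suc n C 2 ≡ n + n C 2
[1+n]C2≡n+nC2 n = trans (sym (nCk+nC[k+1]≡[n+1]C[k+1] n 1)) (cong (_+ n C 2) (nC1≡n n))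

2*[1+n]C2≡n*[1+n] : ∀ n → 2 * (suc n C 2) ≡ n * suc n
2*[1+n]C2≡n*[1+n] zero    = refl
2*[1+n]C2≡n*[1+n] (suc n) = begin
  2 * (suc (suc n) C 2)        ≡⟨ cong (2 *_) ([1+n]C2≡n+nC2 (suc n)) ⟩
  2 * (suc n + suc n C 2)      ≡⟨ *-distribˡ-+ 2 (suc n) (suc n C 2) ⟩
  2 * suc n + 2 * (suc n C 2)  ≡⟨ cong (2 * suc n +_) (2*[1+n]C2≡n*[1+n] n) ⟩
  2 * suc n + n * suc n        ≡⟨ *-distribʳ-+ (suc n) 2 n ⟨
  (2 + n) * suc n              ≡⟨ *-comm (2 + n) (suc n) ⟩
  suc n * suc (suc n)          ∎
  where open ≡-Reasoning

∃∉ : (cs : List (Fin n)) → length cs < n → ∃ λ c → c ∉ cs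
∃∉ {n} cs |cs|<n = ¬∀⟶∃¬ n (_∈ cs) (_∈? cs) ¬all∈
  where
  open import Data.List.Membership.DecPropositional (_≟_ {n}) using (_∈?_)
  ¬all∈ : ¬ (∀ c → c ∈ cs)
  ¬all∈ c∈cs with i , j , i<j , same ← pigeonhole |cs|<n (Any.index ∘ c∈cs) =
    <⇒≢ i<j (index-injective (setoid _) (c∈cs i) (c∈cs j) same)

m*n≤sum : (f : Vector ℕ m) → (∀ i → n ≤ f i) → m * n ≤ sum f
m*n≤sum {zero}  f n≤f = z≤n
m*n≤sum {suc m} f n≤f = +-mono-≤ (n≤f zero) (m*n≤sum (f ∘ suc) (n≤f ∘ suc))

insertAt-punchOut : (g : Vector A m) {v u : Fin (suc m)} (c : A) (v≢u : v ≢ u) →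
                    insertAt g v c u ≡ g (punchOut v≢u)
insertAt-punchOut g {v} c v≢u = begin
  insertAt g v c _                          ≡⟨ cong (insertAt g v c) (punchIn-punchOut v≢u) ⟨
  insertAt g v c (punchIn v (punchOut v≢u)) ≡⟨ insertAt-punchIn g v c (punchOut v≢u) ⟩
  g (punchOut v≢u)                          ∎
  where open ≡-Reasoning

insertAt-≢ : (g : Vector A m) {v u : Fin (suc m)} (c : A) (v≢u : v ≢ u) →
            c ≢ g (punchOut v≢u) → insertAt g v c v ≢ insertAt g v c u
insertAt-≢ g {v} c v≢u c≢ same =
  c≢ (trans (sym (insertAt-lookup g v c)) (trans same (insertAt-punchOut g c v≢u)))

∈-catMaybes⁺ : {x : A} {xs : List (Maybe A)} → just x ∈ xs → x ∈ catMaybes xs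
∈-catMaybes⁺ {xs = just _ ∷ _}  (here refl) = here refl
∈-catMaybes⁺ {xs = just _ ∷ _}  (there p)   = there (∈-catMaybes⁺ p)
∈-catMaybes⁺ {xs = nothing ∷ _} (there p)   = ∈-catMaybes⁺ p

Edge : ℕ → Set
Edge m = Fin m × Fin m

-- Loops impose no condition, so edge lists never need to be filtered for them.
Proper : (Fin m → Fin n) → List (Edge m) → Set
Proper f = All λ (a , b) → a ≢ b → f a ≢ f b

injective⇒proper : {f : Fin m → Fin n} → (∀ {a b} → f a ≡ f b → a ≡ b) →
                   (E : List (Edge m)) → Proper f E
injective⇒proper f-inj E = All.tabulate λ _ a≢b → a≢b ∘ f-inj

δ : Fin m → Fin m → ℕ
δ zero    zero    = 1
δ zero    (suc _) = 0
δ (suc _) zero    = 0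
δ (suc v) (suc a) = δ v a

δ-refl : (v : Fin m) → δ v v ≡ 1
δ-refl zero    = refl
δ-refl (suc v) = δ-refl v

sum-δ : (a : Fin m) → sum (λ v → δ v a) ≡ 1
sum-δ {suc m} zero    = cong suc (sum-replicate-zero m)
sum-δ {suc m} (suc a) = sum-δ a

degree : Fin m → List (Edge m) → ℕ
degree v []            = 0
degree v ((a , b) ∷ E) = δ v a + (δ v b + degree v E)

degree-∷ : (v : Fin m) (e : Edge m) (E : List (Edge m)) → degree v E ≤ degree v (e ∷ E)
degree-∷ v (a , b) E = ≤-trans (m≤n+m _ (δ v b)) (m≤n+m _ (δ v a))

handshake : (E : List (Edge m)) → sum (λ v → degree v E) ≡ 2 * length E
handshake {m} []            = sum-replicate-zero m
handshake     ((a , b) ∷ E) = begin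
  sum (λ v → δ v a + (δ v b + degree v E))
    ≡⟨ ∑-distrib-+ (λ v → δ v a) _ ⟩
  sum (λ v → δ v a) + sum (λ v → δ v b + degree v E)
    ≡⟨ cong (sum (λ v → δ v a) +_) (∑-distrib-+ (λ v → δ v b) _) ⟩
  sum (λ v → δ v a) + (sum (λ v → δ v b) + sum (λ v → degree v E))
    ≡⟨ cong₂ _+_ (sum-δ a) (cong₂ _+_ (sum-δ b) (handshake E)) ⟩
  2 + 2 * length E
    ≡⟨ *-suc 2 (length E) ⟨
  2 * suc (length E) ∎
  where open ≡-Reasoning

∃degree< : ∀ n (E : List (Edge m)) → 2 * length E < n * m → ∃ λ v → degree v E < n
∃degree< {m} n E 2|E|<nm =
  Product.map₂ ≰⇒> (¬∀⟶∃¬ m (λ v → n ≤ degree v E) (λ v → n ≤? degree v E) ¬all≥)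
  where
  open NP.≤-Reasoning
  ¬all≥ : ¬ (∀ v → n ≤ degree v E)
  ¬all≥ n≤degree = <⇒≱ 2|E|<nm (begin
    n * m                   ≡⟨ *-comm n m ⟩
    m * n                   ≤⟨ m*n≤sum (λ v → degree v E) n≤degree ⟩
    sum (λ v → degree v E)  ≡⟨ handshake E ⟩
    2 * length E            ∎)

removeVertex : Fin (suc m) → List (Edge (suc m)) → List (Edge m)
removeVertex v []            = []
removeVertex v ((a , b) ∷ E) with v ≟ a | v ≟ b
... | no v≢a | no v≢b = (punchOut v≢a , punchOut v≢b) ∷ removeVertex v E
... | _      | _      = removeVertex v E

neighbours : Fin (suc m) → List (Edge (suc m)) → List (Fin m)
neighbours v []            = []
neighbours v ((a , b) ∷ E) with v ≟ a | v ≟ b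
... | yes _  | no v≢b = punchOut v≢b ∷ neighbours v E
... | no v≢a | yes _  = punchOut v≢a ∷ neighbours v E
... | _      | _      = neighbours v E

length-removeVertex : (v : Fin (suc m)) (E : List (Edge (suc m))) →
                      length (removeVertex v E) ≤ length E
length-removeVertex v []            = z≤n
length-removeVertex v ((a , b) ∷ E) with v ≟ a | v ≟ b
... | no _  | no _  = s≤s (length-removeVertex v E)
... | yes _ | _     = m≤n⇒m≤1+n (length-removeVertex v E)
... | no _  | yes _ = m≤n⇒m≤1+n (length-removeVertex v E)

length-neighbours : (v : Fin (suc m)) (E : List (Edge (suc m))) →
                    length (neighbours v E) ≤ degree v E
length-neighbours v []            = z≤n
length-neighbours v ((a , b) ∷ E) with v ≟ a | v ≟ b
... | yes refl | no _     rewrite δ-refl v = s≤s (≤-trans (length-neighbours v E) (m≤n+m _ _))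
... | no _     | yes refl rewrite δ-refl v = ≤-trans (s≤s (length-neighbours v E)) (m≤n+m _ (δ v a))
... | yes _    | yes _    = ≤-trans (length-neighbours v E) (degree-∷ v (a , b) E)
... | no _     | no _     = ≤-trans (length-neighbours v E) (degree-∷ v (a , b) E)

insertAt-proper : (g : Fin m → Fin n) (v : Fin (suc m)) (c : Fin n) (E : List (Edge (suc m))) →
                  Proper g (removeVertex v E) → c ∉ map g (neighbours v E) →
                  Proper (insertAt g v c) E
insertAt-proper g v c []            _       _  = []
insertAt-proper g v c ((a , b) ∷ E) g-proper c∉ with v ≟ a | v ≟ b
... | yes refl | yes refl = (λ v≢v → contradiction refl v≢v) ∷ insertAt-proper g v c E g-proper c∉
... | yes refl | no v≢b   = (λ _ → insertAt-≢ g c v≢b (c∉ ∘ here))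
                          ∷ insertAt-proper g v c E g-proper (c∉ ∘ there)
... | no v≢a   | yes refl = (λ _ → insertAt-≢ g c v≢a (c∉ ∘ here) ∘ sym)
                          ∷ insertAt-proper g v c E g-proper (c∉ ∘ there)
... | no v≢a   | no v≢b   = (λ a≢b same → All.head g-proper (a≢b ∘ punchOut-injective v≢a v≢b)
                              (trans (sym (insertAt-punchOut g c v≢a)) (trans same (insertAt-punchOut g c v≢b))))
                          ∷ insertAt-proper g v c E (All.tail g-proper) c∉

<[1+n]C2⇒2*<n* : k < suc n C 2 → n < m → 2 * k < n * m
<[1+n]C2⇒2*<n* {k} {n} {m} k<C n<m = begin-strict
  2 * k            <⟨ *-monoʳ-< 2 k<C ⟩
  2 * (suc n C 2)  ≡⟨ 2*[1+n]C2≡n*[1+n] n ⟩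
  n * suc n        ≤⟨ *-monoʳ-≤ n n<m ⟩
  n * m            ∎
  where open NP.≤-Reasoning

colourable : (E : List (Edge m)) → length E < suc n C 2 → ∃ λ (f : Fin m → Fin n) → Proper f E
colourable {m} {n} E |E|<C with m ≤? n
... | yes m≤n = (λ i → inject≤ i m≤n) , injective⇒proper (inject≤-injective m≤n m≤n _ _) E
colourable {zero}  {n} E |E|<C | no 0≰n = contradiction z≤n 0≰n
colourable {suc m} {n} E |E|<C | no m≰n
  with v , degree<n ← ∃degree< n E (<[1+n]C2⇒2*<n* |E|<C (≰⇒> m≰n))
  with g , g-proper ← colourable (removeVertex v E) (≤-<-trans (length-removeVertex v E) |E|<C)
  with c , c∉ ← ∃∉ (map g (neighbours v E))
                   (≤-<-trans (≤-reflexive (length-map g (neighbours v E)))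
                              (≤-<-trans (length-neighbours v E) degree<n))
  = insertAt g v c , insertAt-proper g v c E g-proper c∉

separating : (Ψ : Fin k → Maybe (Edge m)) → k < suc n C 2 →
             ∃ λ (f : Fin m → Fin n) → ∀ y {i j} → Ψ y ≡ just (i , j) → i ≢ j → f i ≢ f j
separating {k} {m} {n} Ψ k<C = Product.map₂ separates (colourable E |E|<C)
  where
  E : List (Edge m)
  E = catMaybes (tabulate Ψ)
  |E|<C : length E < suc n C 2
  |E|<C = ≤-<-trans (length-catMaybes (tabulate Ψ))
                    (subst (_< suc n C 2) (sym (length-tabulate Ψ)) k<C)
  separates : {f : Fin m → Fin n} → Proper f E → ∀ y {i j} → Ψ y ≡ just (i , j) → i ≢ j → f i ≢ f j
  separates f-proper y Ψy≡ij =
    All.lookup f-proper (∈-catMaybes⁺ (subst (_∈ tabulate Ψ) Ψy≡ij (∈-tabulate⁺ y)))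

PHP≰idP : k < suc n C 2 → ¬ (PHP m n ≤ᴾ idP k)
PHP≰idP k<C record { Φ = Φ ; Ψ = Ψ ; correct = correct }
  with f , f-separates ← separating Ψ k<C
  with _ , Ψy≡ij , i<j , fi≡fj ← correct f (Φ f) refl
  = f-separates (Φ f) Ψy≡ij (<⇒≢ i<j) fi≡fj

lower? : ∀ n → Fin k → Maybe (Fin n)
lower? n y with toℕ y <? n
... | yes y<n = just (fromℕ< y<n)
... | no _    = nothing

lower?-inject≤ : (i : Fin n) (n≤k : n ≤ k) → lower? n (inject≤ i n≤k) ≡ just i
lower?-inject≤ {n} i n≤k with toℕ (inject≤ i n≤k) <? n
... | yes i<n = cong just (toℕ-injective (trans (toℕ-fromℕ< i<n) (toℕ-inject≤ i n≤k)))
... | no i≮n  = contradiction (subst (_< n) (sym (toℕ-inject≤ i n≤k)) (toℕ<n i)) i≮n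

covered⇒≤ᴾidP : {P : Problem} (L : List (Cand P)) → length L ≤ k →
                (∀ x → Any (IsSol P x) L) → P ≤ᴾ idP k
covered⇒≤ᴾidP L |L|≤k covers = record
  { Φ       = λ x → inject≤ (Any.index (covers x)) |L|≤k
  ; Ψ       = λ y → Maybe.map (lookup L) (lower? (length L) y)
  ; correct = λ { x _ refl → lookup L (Any.index (covers x))
                           , cong (Maybe.map (lookup L)) (lower?-inject≤ _ |L|≤k)
                           , lookup-index (covers x) }
  }

pairWith0 : Fin n → Fin (suc n) × Fin (suc n)
pairWith0 j = zero , suc j

sucPair : Fin n × Fin n → Fin (suc n) × Fin (suc n)
sucPair (i , j) = suc i , suc j

increasingPairs : ∀ n → List (Fin n × Fin n)
increasingPairs zero    = []
increasingPairs (suc n) = map pairWith0 (allFin n) ++ map sucPair (increasingPairs n)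

length-increasingPairs : ∀ n → length (increasingPairs n) ≡ n C 2
length-increasingPairs zero    = refl
length-increasingPairs (suc n) = begin
  length (map pairWith0 (allFin n) ++ map sucPair (increasingPairs n))
    ≡⟨ length-++ (map pairWith0 (allFin n)) ⟩
  length (map pairWith0 (allFin n)) + length (map sucPair (increasingPairs n))
    ≡⟨ cong₂ _+_ (trans (length-map pairWith0 (allFin n)) (length-tabulate id))
                 (trans (length-map sucPair (increasingPairs n)) (length-increasingPairs n)) ⟩
  n + n C 2
    ≡⟨ [1+n]C2≡n+nC2 n ⟨
  suc n C 2 ∎
  where open ≡-Reasoning

∈-increasingPairs : {i j : Fin n} → i <ᶠ j → (i , j) ∈ increasingPairs n
∈-increasingPairs {suc n} {zero}  {suc j} _   = ∈-++⁺ˡ (∈-map⁺ pairWith0 (∈-allFin j))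
∈-increasingPairs {suc n} {suc i} {suc j} i<j =
  ∈-++⁺ʳ (map pairWith0 (allFin n)) (∈-map⁺ sucPair (∈-increasingPairs (s<s⁻¹ i<j)))

PHP≤idP : n < m → suc n C 2 ≤ k → PHP m n ≤ᴾ idP k
PHP≤idP {n} {m} {k} n<m C≤k = covered⇒≤ᴾidP pairs |pairs|≤k collision
  where
  pigeon : Fin (suc n) → Fin m
  pigeon i = inject≤ i n<m
  pairs : List (Fin m × Fin m)
  pairs = map (Product.map pigeon pigeon) (increasingPairs (suc n))
  |pairs|≤k : length pairs ≤ k
  |pairs|≤k = begin
    length pairs                     ≡⟨ length-map (Product.map pigeon pigeon) (increasingPairs (suc n)) ⟩
    length (increasingPairs (suc n)) ≡⟨ length-increasingPairs (suc n) ⟩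
    suc n C 2                        ≤⟨ C≤k ⟩
    k                                ∎
    where open NP.≤-Reasoning
  pigeon-< : ∀ {i j} → i <ᶠ j → pigeon i <ᶠ pigeon j
  pigeon-< {i} {j} = subst₂ _<_ (sym (toℕ-inject≤ i n<m)) (sym (toℕ-inject≤ j n<m))
  collision : (f : Fin m → Fin n) → Any (IsSol (PHP m n) f) pairs
  collision f with i , j , i<j , same ← pigeonhole (n<1+n n) (f ∘ pigeon) =
    lose (∈-map⁺ (Product.map pigeon pigeon) (∈-increasingPairs i<j)) (pigeon-< i<j , same)

proposition2p3 : (m n : ℕ) → 2 ≤ n → n < m →
    (¬ (PHP m n ≤ᴾ idP (suc n C 2 ∸ 1)))
    × ((k : ℕ) → 1 ≤ k → ((PHP m n ≤ᴾ idP k) ⇔ (k ≥ suc n C 2)))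
proposition2p3 m n 2≤n n<m =
  PHP≰idP (∸-monoʳ-< z<s 1≤[1+n]C2) ,
  λ k _ → mk⇔ (λ R → ≮⇒≥ λ k<C → PHP≰idP k<C R) (PHP≤idP n<m)
  where
  open NP.≤-Reasoning
  1≤[1+n]C2 : 1 ≤ suc n C 2
  1≤[1+n]C2 = begin
    1          ≤⟨ ≤-trans (s≤s z≤n) 2≤n ⟩
    n          ≤⟨ m≤m+n n (n C 2) ⟩
    n + n C 2  ≡⟨ [1+n]C2≡n+nC2 n ⟨
    suc n C 2  ∎
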